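{- For every positive integer $r$, \[ \sum_{n=0}^\infty \frac{2}{(n+1)(2n+2r+1)}\frac{\binom{2n}{n}}{\binom{2n+2r}{n+r}}=\frac{1}{(2r-1)\binom{2r-2}{r-1}}-\frac{1}{2^{2r-1}r}. \] -}

module Defs where

open import Data.Nat as ℕ using (ℕ; zero; suc; _≤_)
open import Data.Nat.Combinatorics using (_C_)
open import Data.Integer using (+_)
open import Data.Rational using (ℚ; 0ℚ; _+_; _-_; _*_; _/_; _<_; ∣_∣)
open import Data.Product using (∃)

-- a / d as a rational number.  Only ever applied below to denominators that
-- are provably positive; the value at d = 0 (namely 0) is never used.
frac : ℕ → ℕ → ℚ
frac a zero    = 0ℚ
frac a (suc d) = (+ a) / suc d

partialSum : (ℕ → ℚ) → ℕ → ℚ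
partialSum f zero    = 0ℚ
partialSum f (suc m) = partialSum f m + f m

-- the series Σ_{n ≥ 0} f n converges (in ℚ, hence in ℝ) to L
SeriesSumsTo : (ℕ → ℚ) → ℚ → Set
SeriesSumsTo f L =
  ∀ (ε : ℚ) → 0ℚ < ε → ∃ λ (N : ℕ) → ∀ (m : ℕ) → N ≤ m → ∣ partialSum f m - L ∣ < ε

term : ℕ → ℕ → ℚ
term r n = frac 2 ((suc n) ℕ.* (2 ℕ.* n ℕ.+ 2 ℕ.* r ℕ.+ 1))
         * frac ((2 ℕ.* n) C n) ((2 ℕ.* n ℕ.+ 2 ℕ.* r) C (n ℕ.+ r))

rhs : ℕ → ℚ
rhs r = frac 1 ((2 ℕ.* r ℕ.∸ 1) ℕ.* ((2 ℕ.* r ℕ.∸ 2) C (r ℕ.∸ 1)))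
      - frac 1 ((2 ℕ.^ (2 ℕ.* r ℕ.∸ 1)) ℕ.* r)

-- Write B n for the central binomial coefficient C(2n, n).  By the recurrence
-- (n + 1) B (n + 1) = 2 (2n + 1) B n the summand telescopes: it equals
-- P n − P (n + 1) for the potential P n = 2 B n / (r B (n + r)).  Hence the m-th
-- partial sum is P 0 − P m, and P 0 is the first term of the right-hand side.
-- Iterating the recurrence gives B (m + r) ≤ 4^r B m together with the
-- Bernoulli-type bound 4^r B m (1 − r / (2m + 2)) ≤ B (m + r), which squeeze
-- P m between 2 / (r 4^r) (the second term) and 2 / (r 4^r) + 1 / (m + 1).

module Submission where

open import Defs
open import Data.Nat
open import Data.Nat.Properties
open import Data.Nat.Combinatorics using (_C_; nC1≡n; nCk+nC[k+1]≡[n+1]C[k+1]; nCk≡nC[n∸k])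
open import Data.Nat.Tactic.RingSolver using (solve-∀)
import Data.Integer as ℤ
import Data.Integer.Properties as ℤP
open import Data.Rational as ℚ using (ℚ; 0ℚ; mkℚ; ∣_∣)
import Data.Rational.Properties as ℚP
import Data.Rational.Unnormalised as ℚᵘ
import Data.Rational.Unnormalised.Properties as ℚᵘP
open import Data.Product using (∃; _,_)
open import Relation.Binary.PropositionalEquality


[1+k]*[1+n]C[1+k]≡[1+n]*nCk : ∀ n k → suc k * (suc n C suc k) ≡ suc n * (n C k)
[1+k]*[1+n]C[1+k]≡[1+n]*nCk zero    zero    = refl
[1+k]*[1+n]C[1+k]≡[1+n]*nCk zero    (suc k) = *-zeroʳ (2 + k)
[1+k]*[1+n]C[1+k]≡[1+n]*nCk (suc n) zero    =
  trans (+-identityʳ _) (trans (nC1≡n (2 + n)) (sym (*-identityʳ (2 + n))))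
[1+k]*[1+n]C[1+k]≡[1+n]*nCk (suc n) (suc k) = begin
    (2 + k) * (suc (suc n) C suc (suc k))
      ≡⟨ cong ((2 + k) *_) (nCk+nC[k+1]≡[n+1]C[k+1] (suc n) (suc k)) ⟨
    (2 + k) * (c + suc n C suc (suc k))
      ≡⟨ regroup k c (suc n C suc (suc k)) ⟩
    c + (suc k * c + (2 + k) * (suc n C suc (suc k)))
      ≡⟨ cong₂ (λ x y → c + (x + y)) ([1+k]*[1+n]C[1+k]≡[1+n]*nCk n k)
                                     ([1+k]*[1+n]C[1+k]≡[1+n]*nCk n (suc k)) ⟩
    c + (suc n * (n C k) + suc n * (n C suc k))
      ≡⟨ cong (c +_) (*-distribˡ-+ (suc n) (n C k) (n C suc k)) ⟨
    c + suc n * (n C k + n C suc k)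
      ≡⟨ cong (λ x → c + suc n * x) (nCk+nC[k+1]≡[n+1]C[k+1] n k) ⟩
    c + suc n * c ∎
  where
  open ≡-Reasoning
  c = suc n C suc k
  regroup : ∀ k c d → (2 + k) * (c + d) ≡ c + (suc k * c + (2 + k) * d)
  regroup = solve-∀

centralBinomial : ℕ → ℕ
centralBinomial n = (2 * n) C n

centralBinomial-suc : ∀ k → suc k * centralBinomial (suc k) ≡ 2 * (1 + 2 * k) * centralBinomial k
centralBinomial-suc k = begin
    suc k * ((2 * suc k) C suc k)
      ≡⟨ cong (λ m → suc k * (m C suc k)) (*-suc 2 k) ⟩
    suc k * ((2 + 2 * k) C suc k)
      ≡⟨ cong (suc k *_) (nCk+nC[k+1]≡[n+1]C[k+1] (1 + 2 * k) k) ⟨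
    suc k * ((1 + 2 * k) C k + c)
      ≡⟨ cong (λ x → suc k * (x + c)) middle-symmetry ⟩
    suc k * (c + c)
      ≡⟨ double (suc k) c ⟩
    2 * (suc k * c)
      ≡⟨ cong (2 *_) ([1+k]*[1+n]C[1+k]≡[1+n]*nCk (2 * k) k) ⟩
    2 * ((1 + 2 * k) * centralBinomial k)
      ≡⟨ *-assoc 2 (1 + 2 * k) (centralBinomial k) ⟨
    2 * (1 + 2 * k) * centralBinomial k ∎
  where
  open ≡-Reasoning
  c = (1 + 2 * k) C suc k
  double : ∀ x c → x * (c + c) ≡ 2 * (x * c)
  double = solve-∀
  split : ∀ k → 1 + 2 * k ≡ k + suc k
  split = solve-∀
  middle-symmetry : (1 + 2 * k) C k ≡ c
  middle-symmetry = begin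
    (1 + 2 * k) C k               ≡⟨ nCk≡nC[n∸k] (m≤n⇒m≤1+n (m≤n*m k 2)) ⟩
    (1 + 2 * k) C (1 + 2 * k ∸ k) ≡⟨ cong (λ m → (1 + 2 * k) C (m ∸ k)) (split k) ⟩
    (1 + 2 * k) C (k + suc k ∸ k) ≡⟨ cong ((1 + 2 * k) C_) (m+n∸m≡n k (suc k)) ⟩
    c                             ∎

centralBinomial-≤-suc : ∀ k → centralBinomial k ≤ centralBinomial (suc k)
centralBinomial-≤-suc k = *-cancelˡ-≤ (suc k) (begin
    suc k * centralBinomial k             ≤⟨ *-monoˡ-≤ (centralBinomial k) 1+k≤2[1+2k] ⟩
    2 * (1 + 2 * k) * centralBinomial k   ≡⟨ centralBinomial-suc k ⟨
    suc k * centralBinomial (suc k)       ∎)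
  where
  open ≤-Reasoning
  1+k≤2[1+2k] : suc k ≤ 2 * (1 + 2 * k)
  1+k≤2[1+2k] = ≤-trans (s≤s (m≤n*m k 2)) (m≤n*m (1 + 2 * k) 2)

centralBinomial-mono-≤ : ∀ {m n} → m ≤ n → centralBinomial m ≤ centralBinomial n
centralBinomial-mono-≤ m≤n = mono′ (≤⇒≤′ m≤n)
  where
  mono′ : ∀ {m n} → m ≤′ n → centralBinomial m ≤ centralBinomial n
  mono′ (≤′-reflexive refl) = ≤-refl
  mono′ (≤′-step {n} m≤′n)  = ≤-trans (mono′ m≤′n) (centralBinomial-≤-suc n)

centralBinomial>0 : ∀ n → 0 < centralBinomial n
centralBinomial>0 n = centralBinomial-mono-≤ {0} {n} z≤n

centralBinomial-suc-≤ : ∀ k → centralBinomial (suc k) ≤ 4 * centralBinomial k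
centralBinomial-suc-≤ k = *-cancelˡ-≤ (suc k) (begin
    suc k * centralBinomial (suc k)       ≡⟨ centralBinomial-suc k ⟩
    2 * (1 + 2 * k) * centralBinomial k   ≤⟨ *-monoˡ-≤ (centralBinomial k) (m≤m+n (2 * (1 + 2 * k)) 2) ⟩
    (2 * (1 + 2 * k) + 2) * centralBinomial k
                                          ≡⟨ regroup k (centralBinomial k) ⟩
    suc k * (4 * centralBinomial k)       ∎)
  where
  open ≤-Reasoning
  regroup : ∀ k b → (2 * (1 + 2 * k) + 2) * b ≡ suc k * (4 * b)
  regroup = solve-∀

centralBinomial-+-≤ : ∀ m r → centralBinomial (m + r) ≤ 4 ^ r * centralBinomial m
centralBinomial-+-≤ m zero =
  ≤-reflexive (trans (cong centralBinomial (+-identityʳ m)) (sym (*-identityˡ (centralBinomial m))))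
centralBinomial-+-≤ m (suc r) rewrite +-suc m r = begin
    centralBinomial (suc (m + r))         ≤⟨ centralBinomial-suc-≤ (m + r) ⟩
    4 * centralBinomial (m + r)           ≤⟨ *-monoʳ-≤ 4 (centralBinomial-+-≤ m r) ⟩
    4 * (4 ^ r * centralBinomial m)       ≡⟨ *-assoc 4 (4 ^ r) (centralBinomial m) ⟨
    4 ^ suc r * centralBinomial m         ∎
  where open ≤-Reasoning

centralBinomial-deficit : ∀ s →
  suc s * (4 * centralBinomial s) ≡ suc s * centralBinomial (suc s) + 2 * centralBinomial s
centralBinomial-deficit s = begin
    suc s * (4 * centralBinomial s)
      ≡⟨ regroup s (centralBinomial s) ⟩
    2 * (1 + 2 * s) * centralBinomial s + 2 * centralBinomial s
      ≡⟨ cong (_+ 2 * centralBinomial s) (centralBinomial-suc s) ⟨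
    suc s * centralBinomial (suc s) + 2 * centralBinomial s ∎
  where
  open ≡-Reasoning
  regroup : ∀ s b → suc s * (4 * b) ≡ 2 * (1 + 2 * s) * b + 2 * b
  regroup = solve-∀

centralBinomial-suc-≥ : ∀ {m s} → m ≤ s →
  2 * suc m * (4 * centralBinomial s) ≤ 2 * suc m * centralBinomial (suc s) + 4 * centralBinomial s
centralBinomial-suc-≥ {m} {s} m≤s = *-cancelˡ-≤ (suc s) (begin
    suc s * (2 * suc m * (4 * b))
      ≡⟨ swap (suc s) (2 * suc m) (4 * b) ⟩
    2 * suc m * (suc s * (4 * b))
      ≡⟨ cong (2 * suc m *_) (centralBinomial-deficit s) ⟩
    2 * suc m * (suc s * b′ + 2 * b)
      ≡⟨ distribute m s b′ b ⟩
    suc s * (2 * suc m * b′) + suc m * (4 * b)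
      ≤⟨ +-monoʳ-≤ (suc s * (2 * suc m * b′)) (*-monoˡ-≤ (4 * b) (s≤s m≤s)) ⟩
    suc s * (2 * suc m * b′) + suc s * (4 * b)
      ≡⟨ *-distribˡ-+ (suc s) (2 * suc m * b′) (4 * b) ⟨
    suc s * (2 * suc m * b′ + 4 * b) ∎)
  where
  open ≤-Reasoning
  b = centralBinomial s
  b′ = centralBinomial (suc s)
  swap : ∀ x y z → x * (y * z) ≡ y * (x * z)
  swap = solve-∀
  distribute : ∀ m s c b → 2 * suc m * (suc s * c + 2 * b) ≡ suc s * (2 * suc m * c) + suc m * (4 * b)
  distribute = solve-∀

centralBinomial-+-≥ : ∀ m r →
  2 * suc m * (4 ^ r * centralBinomial m) ≤ 2 * suc m * centralBinomial (m + r) + r * (4 ^ r * centralBinomial m)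
centralBinomial-+-≥ m zero = ≤-reflexive (begin-equality
    2 * suc m * (1 * centralBinomial m)
      ≡⟨ cong (2 * suc m *_) (*-identityˡ (centralBinomial m)) ⟩
    2 * suc m * centralBinomial m
      ≡⟨ cong (λ k → 2 * suc m * centralBinomial k) (+-identityʳ m) ⟨
    2 * suc m * centralBinomial (m + 0)
      ≡⟨ +-identityʳ _ ⟨
    2 * suc m * centralBinomial (m + 0) + 0 ∎)
  where open ≤-Reasoning
centralBinomial-+-≥ m (suc r) rewrite +-suc m r = begin
    M * (4 * F * P)
      ≡⟨ pull-4 M F P ⟩
    4 * (M * (F * P))
      ≤⟨ *-monoʳ-≤ 4 (centralBinomial-+-≥ m r) ⟩
    4 * (M * centralBinomial (m + r) + r * (F * P))
      ≡⟨ push-4 M (centralBinomial (m + r)) r F P ⟩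
    M * (4 * centralBinomial (m + r)) + r * (4 * F * P)
      ≤⟨ +-monoˡ-≤ (r * (4 * F * P)) (centralBinomial-suc-≥ (m≤m+n m r)) ⟩
    M * centralBinomial (suc (m + r)) + 4 * centralBinomial (m + r) + r * (4 * F * P)
      ≤⟨ +-monoˡ-≤ (r * (4 * F * P))
           (+-monoʳ-≤ (M * centralBinomial (suc (m + r))) (*-monoʳ-≤ 4 (centralBinomial-+-≤ m r))) ⟩
    M * centralBinomial (suc (m + r)) + 4 * (F * P) + r * (4 * F * P)
      ≡⟨ collect (M * centralBinomial (suc (m + r))) r F P ⟩
    M * centralBinomial (suc (m + r)) + suc r * (4 * F * P) ∎
  where
  open ≤-Reasoning
  M = 2 * suc m
  F = 4 ^ r
  P = centralBinomial m
  pull-4 : ∀ M F P → M * (4 * F * P) ≡ 4 * (M * (F * P))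
  pull-4 = solve-∀
  push-4 : ∀ M Q r F P → 4 * (M * Q + r * (F * P)) ≡ M * (4 * Q) + r * (4 * F * P)
  push-4 = solve-∀
  collect : ∀ X r F P → X + 4 * (F * P) + r * (4 * F * P) ≡ X + suc r * (4 * F * P)
  collect = solve-∀

toℚᵘ-frac : ∀ a d → ℚ.toℚᵘ (frac a (suc d)) ℚᵘ.≃ ℚᵘ.mkℚᵘ (ℤ.+ a) d
toℚᵘ-frac a d = ℚP.toℚᵘ-fromℚᵘ (ℚᵘ.mkℚᵘ (ℤ.+ a) d)

frac-cong : ∀ {a b d e} → 0 < d → 0 < e → a * e ≡ b * d → frac a d ≡ frac b e
frac-cong {a} {b} {suc d} {suc e} _ _ ae≡bd = ℚP.toℚᵘ-injective
  (ℚᵘP.≃-trans (toℚᵘ-frac a d) (ℚᵘP.≃-trans (ℚᵘ.*≡* cross) (ℚᵘP.≃-sym (toℚᵘ-frac b e))))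
  where
  cross : ℤ.+ a ℤ.* ℤ.+ suc e ≡ ℤ.+ b ℤ.* ℤ.+ suc d
  cross = trans (sym (ℤP.pos-* a (suc e))) (trans (cong ℤ.+_ ae≡bd) (ℤP.pos-* b (suc d)))

frac-mono-≤ : ∀ {a b d e} → 0 < d → 0 < e → a * e ≤ b * d → frac a d ℚ.≤ frac b e
frac-mono-≤ {a} {b} {suc d} {suc e} _ _ ae≤bd = ℚP.toℚᵘ-cancel-≤
  (ℚᵘP.≤-respˡ-≃ (ℚᵘP.≃-sym (toℚᵘ-frac a d))
  (ℚᵘP.≤-respʳ-≃ (ℚᵘP.≃-sym (toℚᵘ-frac b e)) (ℚᵘ.*≤* cross)))
  where
  cross : ℤ.+ a ℤ.* ℤ.+ suc e ℤ.≤ ℤ.+ b ℤ.* ℤ.+ suc d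
  cross = subst₂ ℤ._≤_ (ℤP.pos-* a (suc e)) (ℤP.pos-* b (suc d)) (ℤ.+≤+ ae≤bd)

frac-mono-< : ∀ {a b d e} → 0 < d → 0 < e → a * e < b * d → frac a d ℚ.< frac b e
frac-mono-< {a} {b} {suc d} {suc e} _ _ ae<bd = ℚP.toℚᵘ-cancel-<
  (ℚᵘP.<-respˡ-≃ (ℚᵘP.≃-sym (toℚᵘ-frac a d))
  (ℚᵘP.<-respʳ-≃ (ℚᵘP.≃-sym (toℚᵘ-frac b e)) (ℚᵘ.*<* cross)))
  where
  cross : ℤ.+ a ℤ.* ℤ.+ suc e ℤ.< ℤ.+ b ℤ.* ℤ.+ suc d
  cross = subst₂ ℤ._<_ (ℤP.pos-* a (suc e)) (ℤP.pos-* b (suc d)) (ℤ.+<+ ae<bd)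

frac-* : ∀ a b {d e} → 0 < d → 0 < e → frac a d ℚ.* frac b e ≡ frac (a * b) (d * e)
frac-* a b {suc d} {suc e} _ _ = ℚP.toℚᵘ-injective
  (ℚᵘP.≃-trans (ℚP.toℚᵘ-homo-* (frac a (suc d)) (frac b (suc e)))
  (ℚᵘP.≃-trans (ℚᵘP.*-cong (toℚᵘ-frac a d) (toℚᵘ-frac b e))
  (ℚᵘP.≃-trans (ℚᵘ.*≡* cross) (ℚᵘP.≃-sym (toℚᵘ-frac (a * b) _)))))
  where
  cross : (ℤ.+ a ℤ.* ℤ.+ b) ℤ.* ℤ.+ (suc d * suc e) ≡ ℤ.+ (a * b) ℤ.* ℤ.+ (suc d * suc e)
  cross = cong (ℤ._* ℤ.+ (suc d * suc e)) (sym (ℤP.pos-* a b))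

frac-+ : ∀ a b {d e} → 0 < d → 0 < e → frac a d ℚ.+ frac b e ≡ frac (a * e + b * d) (d * e)
frac-+ a b {suc d} {suc e} _ _ = ℚP.toℚᵘ-injective
  (ℚᵘP.≃-trans (ℚP.toℚᵘ-homo-+ (frac a (suc d)) (frac b (suc e)))
  (ℚᵘP.≃-trans (ℚᵘP.+-cong (toℚᵘ-frac a d) (toℚᵘ-frac b e))
  (ℚᵘP.≃-trans (ℚᵘ.*≡* cross) (ℚᵘP.≃-sym (toℚᵘ-frac (a * suc e + b * suc d) _)))))
  where
  numerator : ℤ.+ a ℤ.* ℤ.+ suc e ℤ.+ ℤ.+ b ℤ.* ℤ.+ suc d ≡ ℤ.+ (a * suc e + b * suc d)
  numerator = trans (cong₂ ℤ._+_ (sym (ℤP.pos-* a (suc e))) (sym (ℤP.pos-* b (suc d))))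
                    (sym (ℤP.pos-+ (a * suc e) (b * suc d)))
  cross : (ℤ.+ a ℤ.* ℤ.+ suc e ℤ.+ ℤ.+ b ℤ.* ℤ.+ suc d) ℤ.* ℤ.+ (suc d * suc e)
        ≡ ℤ.+ (a * suc e + b * suc d) ℤ.* ℤ.+ (suc d * suc e)
  cross = cong (ℤ._* ℤ.+ (suc d * suc e)) numerator

partialSum-telescope : ∀ (f g : ℕ → ℚ) → (∀ n → f n ℚ.+ g (suc n) ≡ g n) →
                       ∀ m → partialSum f m ℚ.+ g m ≡ g 0
partialSum-telescope f g step zero    = ℚP.+-identityˡ (g 0)
partialSum-telescope f g step (suc m) = begin
    partialSum f m ℚ.+ f m ℚ.+ g (suc m)    ≡⟨ ℚP.+-assoc (partialSum f m) (f m) (g (suc m)) ⟩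
    partialSum f m ℚ.+ (f m ℚ.+ g (suc m))  ≡⟨ cong (partialSum f m ℚ.+_) (step m) ⟩
    partialSum f m ℚ.+ g m                  ≡⟨ partialSum-telescope f g step m ⟩
    g 0                                     ∎
  where open ≡-Reasoning

∣s-[x₀-y]∣≤δ : ∀ {s x x₀ y δ} → s ℚ.+ x ≡ x₀ → y ℚ.≤ x → x ℚ.≤ y ℚ.+ δ →
               ∣ s ℚ.- (x₀ ℚ.- y) ∣ ℚ.≤ δ
∣s-[x₀-y]∣≤δ {s} {x} {_} {y} {δ} refl y≤x x≤y+δ = begin
    ∣ s ℚ.- ((s ℚ.+ x) ℚ.- y) ∣   ≡⟨ cong ∣_∣ (solve 3 (λ s x y → s :- ((s :+ x) :- y) := :- (x :- y))
                                                  refl s x y) ⟩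
    ∣ ℚ.- (x ℚ.- y) ∣             ≡⟨ ℚP.∣-p∣≡∣p∣ (x ℚ.- y) ⟩
    ∣ x ℚ.- y ∣                   ≡⟨ ℚP.0≤p⇒∣p∣≡p 0≤x-y ⟩
    x ℚ.- y                       ≤⟨ ℚP.+-monoˡ-≤ (ℚ.- y) x≤y+δ ⟩
    y ℚ.+ δ ℚ.- y                 ≡⟨ solve 2 (λ y δ → y :+ δ :- y := δ) refl y δ ⟩
    δ                             ∎
  where
  open ℚP.≤-Reasoning
  open import Data.Rational.Solver using (module +-*-Solver)
  open +-*-Solver
  0≤x-y : 0ℚ ℚ.≤ x ℚ.- y
  0≤x-y = subst (ℚ._≤ x ℚ.- y) (ℚP.+-inverseʳ y) (ℚP.+-monoˡ-≤ (ℚ.- y) y≤x)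

frac-1-suc-eventually-< : ∀ ε → 0ℚ ℚ.< ε → ∃ λ N → ∀ m → N ≤ m → frac 1 (suc m) ℚ.< ε
frac-1-suc-eventually-< (mkℚ (ℤ.+ zero) _ _) ε>0 with ℚ.positive ε>0
... | ()
frac-1-suc-eventually-< (mkℚ ℤ.-[1+ _ ] _ _) ε>0 with ℚ.positive ε>0
... | ()
frac-1-suc-eventually-< ε@(mkℚ (ℤ.+ suc a) d _) _ = suc d , λ m N≤m →
  subst (frac 1 (suc m) ℚ.<_) (ℚP.↥p/↧p≡p ε) (frac-mono-< {1} {suc a} {suc m} {suc d} z<s z<s (begin-strict
    1 * suc d      ≡⟨ *-identityˡ (suc d) ⟩
    suc d          <⟨ s≤s N≤m ⟩
    suc m          ≤⟨ m≤n*m (suc m) (suc a) ⟩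
    suc a * suc m  ∎))
  where open ≤-Reasoning

seriesSumsTo-of-rate : ∀ {f L} → (∀ m → ∣ partialSum f m ℚ.- L ∣ ℚ.≤ frac 1 (suc m)) →
                       SeriesSumsTo f L
seriesSumsTo-of-rate bound ε ε>0 with frac-1-suc-eventually-< ε ε>0
... | N , small = N , λ m N≤m → ℚP.≤-<-trans (bound m) (small m N≤m)

module Telescoping (r : ℕ) (r>0 : 0 < r) where

  potential : ℕ → ℚ
  potential m = frac (2 * centralBinomial m) (r * centralBinomial (m + r))

  limit : ℚ
  limit = frac 2 (r * 4 ^ r)

  private
    r*centralBinomial>0 : ∀ m → 0 < r * centralBinomial m
    r*centralBinomial>0 m = *-mono-< r>0 (centralBinomial>0 m)

    r*4^r>0 : 0 < r * 4 ^ r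
    r*4^r>0 = *-mono-< r>0 (m^n>0 4 r)

    2n+2r+1>0 : ∀ n → 0 < 2 * n + 2 * r + 1
    2n+2r+1>0 n = m≤n+m 1 (2 * n + 2 * r)

  term≡frac : ∀ n →
    term r n ≡ frac (2 * centralBinomial n) (suc n * (2 * n + 2 * r + 1) * centralBinomial (n + r))
  term≡frac n = begin
      term r n
        ≡⟨ cong (λ k → frac 2 D ℚ.* frac (centralBinomial n) (k C (n + r))) (*-distribˡ-+ 2 n r) ⟨
      frac 2 D ℚ.* frac (centralBinomial n) (centralBinomial (n + r))
        ≡⟨ frac-* 2 (centralBinomial n) (*-mono-< (z<s {n}) (2n+2r+1>0 n)) (centralBinomial>0 (n + r)) ⟩
      frac (2 * centralBinomial n) (D * centralBinomial (n + r)) ∎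
    where
    open ≡-Reasoning
    D = suc n * (2 * n + 2 * r + 1)

  potential-suc : ∀ n → potential (suc n) ≡
    frac (2 * (1 + 2 * n) * suc (n + r) * centralBinomial n) (r * suc n * (2 * n + 2 * r + 1) * centralBinomial (n + r))
  potential-suc n = frac-cong (r*centralBinomial>0 (suc n + r))
      (*-mono-< (*-mono-< (*-mono-< r>0 (z<s {n})) (2n+2r+1>0 n)) (centralBinomial>0 (n + r))) (begin
      2 * p′ * (r * suc n * (2 * n + 2 * r + 1) * q)
        ≡⟨ expose n r p′ q ⟩
      r * (suc n * p′) * (2 * (1 + 2 * (n + r)) * q)
        ≡⟨ cong₂ (λ x y → r * x * y) (centralBinomial-suc n) (sym (centralBinomial-suc (n + r))) ⟩
      r * (2 * (1 + 2 * n) * p) * (suc (n + r) * q′)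
        ≡⟨ collect n r p q′ ⟩
      2 * (1 + 2 * n) * suc (n + r) * p * (r * q′) ∎)
    where
    open ≡-Reasoning
    p = centralBinomial n
    p′ = centralBinomial (suc n)
    q = centralBinomial (n + r)
    q′ = centralBinomial (suc (n + r))
    expose : ∀ n r p′ q →
      2 * p′ * (r * suc n * (2 * n + 2 * r + 1) * q) ≡ r * (suc n * p′) * (2 * (1 + 2 * (n + r)) * q)
    expose = solve-∀
    collect : ∀ n r p q′ →
      r * (2 * (1 + 2 * n) * p) * (suc (n + r) * q′) ≡ 2 * (1 + 2 * n) * suc (n + r) * p * (r * q′)
    collect = solve-∀

  term+potential-suc≡potential : ∀ n → term r n ℚ.+ potential (suc n) ≡ potential n
  term+potential-suc≡potential n = begin
      term r n ℚ.+ potential (suc n)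
        ≡⟨ cong₂ ℚ._+_ (term≡frac n) (potential-suc n) ⟩
      frac a d ℚ.+ frac b e
        ≡⟨ frac-+ a b d>0 e>0 ⟩
      frac (a * e + b * d) (d * e)
        ≡⟨ frac-cong (*-mono-< d>0 e>0) (r*centralBinomial>0 (n + r)) (cross n r p q) ⟩
      potential n ∎
    where
    open ≡-Reasoning
    p = centralBinomial n
    q = centralBinomial (n + r)
    a = 2 * p
    b = 2 * (1 + 2 * n) * suc (n + r) * p
    d = suc n * (2 * n + 2 * r + 1) * q
    e = r * suc n * (2 * n + 2 * r + 1) * q
    d>0 : 0 < d
    d>0 = *-mono-< (*-mono-< (z<s {n}) (2n+2r+1>0 n)) (centralBinomial>0 (n + r))
    e>0 : 0 < e
    e>0 = *-mono-< (*-mono-< (*-mono-< r>0 (z<s {n})) (2n+2r+1>0 n)) (centralBinomial>0 (n + r))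
    -- holds because r + (1 + 2n)(n + r + 1) = (n + 1)(2n + 2r + 1)
    cross : ∀ n r p q →
      (2 * p * (r * suc n * (2 * n + 2 * r + 1) * q)
        + 2 * (1 + 2 * n) * suc (n + r) * p * (suc n * (2 * n + 2 * r + 1) * q)) * (r * q)
      ≡ 2 * p * (suc n * (2 * n + 2 * r + 1) * q * (r * suc n * (2 * n + 2 * r + 1) * q))
    cross = solve-∀

  limit≤potential : ∀ m → limit ℚ.≤ potential m
  limit≤potential m = frac-mono-≤ r*4^r>0 (r*centralBinomial>0 (m + r)) (begin
      2 * (r * q)            ≡⟨ *-assoc 2 r q ⟨
      2 * r * q              ≤⟨ *-monoʳ-≤ (2 * r) (centralBinomial-+-≤ m r) ⟩
      2 * r * (4 ^ r * p)    ≡⟨ regroup r (4 ^ r) p ⟩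
      2 * p * (r * 4 ^ r)    ∎)
    where
    open ≤-Reasoning
    p = centralBinomial m
    q = centralBinomial (m + r)
    regroup : ∀ r F p → 2 * r * (F * p) ≡ 2 * p * (r * F)
    regroup = solve-∀

  potential≤limit+frac-1-suc : ∀ m → potential m ℚ.≤ limit ℚ.+ frac 1 (suc m)
  potential≤limit+frac-1-suc m = subst (potential m ℚ.≤_) (sym (frac-+ 2 1 r*4^r>0 (z<s {m})))
    (frac-mono-≤ (r*centralBinomial>0 (m + r)) (*-mono-< r*4^r>0 (z<s {m})) (begin
      2 * p * (r * F * suc m)                ≡⟨ regroup₁ m r F p ⟩
      r * (2 * suc m * (F * p))              ≤⟨ *-monoʳ-≤ r (centralBinomial-+-≥ m r) ⟩
      r * (2 * suc m * q + r * (F * p))      ≤⟨ *-monoʳ-≤ r (+-monoʳ-≤ (2 * suc m * q)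
                                                                  (*-monoʳ-≤ r (*-monoʳ-≤ F p≤q))) ⟩
      r * (2 * suc m * q + r * (F * q))      ≡⟨ regroup₂ m r F q ⟩
      (2 * suc m + 1 * (r * F)) * (r * q)    ∎))
    where
    open ≤-Reasoning
    F = 4 ^ r
    p = centralBinomial m
    q = centralBinomial (m + r)
    p≤q : p ≤ q
    p≤q = centralBinomial-mono-≤ (m≤m+n m r)
    regroup₁ : ∀ m r F p → 2 * p * (r * F * suc m) ≡ r * (2 * suc m * (F * p))
    regroup₁ = solve-∀
    regroup₂ : ∀ m r F q → r * (2 * suc m * q + r * (F * q)) ≡ (2 * suc m + 1 * (r * F)) * (r * q)
    regroup₂ = solve-∀

rhs≡potential-limit : ∀ s → let open Telescoping (suc s) z<s in rhs (suc s) ≡ potential 0 ℚ.- limit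
rhs≡potential-limit s = begin
    rhs (suc s)
      ≡⟨ cong (λ t → frac 1 ((t ∸ 1) * ((t ∸ 2) C s)) ℚ.- frac 1 (2 ^ (t ∸ 1) * suc s)) (*-suc 2 s) ⟩
    frac 1 ((1 + 2 * s) * centralBinomial s) ℚ.- frac 1 (2 ^ (1 + 2 * s) * suc s)
      ≡⟨ cong₂ ℚ._-_ potential-0 limit-as-power-of-2 ⟩
    potential 0 ℚ.- limit ∎
  where
  open ≡-Reasoning
  open Telescoping (suc s) z<s
  potential-0 : frac 1 ((1 + 2 * s) * centralBinomial s) ≡ potential 0
  potential-0 = frac-cong (*-mono-< (z<s {2 * s}) (centralBinomial>0 s))
                          (*-mono-< (z<s {s}) (centralBinomial>0 (suc s)))
    (trans (*-identityˡ _) (trans (centralBinomial-suc s) (*-assoc 2 (1 + 2 * s) (centralBinomial s))))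
  limit-as-power-of-2 : frac 1 (2 ^ (1 + 2 * s) * suc s) ≡ limit
  limit-as-power-of-2 = frac-cong (*-mono-< (m^n>0 2 (1 + 2 * s)) (z<s {s})) (*-mono-< (z<s {s}) (m^n>0 4 (suc s)))
    (begin
      1 * (suc s * (4 * 4 ^ s))           ≡⟨ cong (λ g → 1 * (suc s * (4 * g))) (^-*-assoc 2 2 s) ⟩
      1 * (suc s * (4 * 2 ^ (2 * s)))     ≡⟨ regroup s (2 ^ (2 * s)) ⟩
      2 * (2 * 2 ^ (2 * s) * suc s)       ∎)
    where
    regroup : ∀ s g → 1 * (suc s * (4 * g)) ≡ 2 * (2 * g * suc s)
    regroup = solve-∀

theorem9 : (r : ℕ) → 1 ≤ r → SeriesSumsTo (term r) (rhs r)
theorem9 (suc k) _ = seriesSumsTo-of-rate error-bound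
  where
  open Telescoping (suc k) z<s
  error-bound : ∀ m → ∣ partialSum (term (suc k)) m ℚ.- rhs (suc k) ∣ ℚ.≤ frac 1 (suc m)
  error-bound m rewrite rhs≡potential-limit k =
    ∣s-[x₀-y]∣≤δ {s = partialSum (term (suc k)) m}
      (partialSum-telescope (term (suc k)) potential term+potential-suc≡potential m)
      (limit≤potential m) (potential≤limit+frac-1-suc m)
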